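{- Let $n, k$ be positive integers such that $\lfloor n/2 \rfloor < k \leq n-1$, and let $m \in \{2,3, \ldots, n-1 \}$ be an integer such that $n-\lceil n/m \rceil < k \leq n-\lceil n/(m+1) \rceil$. Then $\{m+1, m+2, \ldots, k+1\} \subseteq \mathrm{Spec}(P_n, k)$.
   Context: $P_n$ is the path on $n$ vertices $v_1,\dots,v_n$ (in order), with graph distance $\mathrm{dist}(v_i,v_j)=|i-j|$; its diameter is $n-1$. For a set $D$ of positive integers, the distance graph $G(P_n,D)$ has vertex set $\{v_1,\dots,v_n\}$, with $v_i,v_j$ ($i\ne j$) adjacent iff $|i-j|\in D$; $\chi(P_n,D)$ is its chromatic number. The Babai $k$-spectrum is $\mathrm{Spec}(P_n,k)=\{\chi(P_n,D): D\subseteq\{1,2,\dots,n-1\},\ |D|=k\}$. -}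

module Defs where

open import Data.Nat using (ℕ; zero; suc; _+_; _∸_; _≤_; _<_; NonZero)
open import Data.Nat.DivMod using (_/_)
open import Data.Fin using (Fin; toℕ)
open import Data.List using (List; length)
open import Data.List.Membership.Propositional using (_∈_)
open import Data.List.Relation.Unary.Unique.Propositional using (Unique)
open import Data.Product using (Σ; _×_; ∃)
open import Relation.Binary.PropositionalEquality using (_≡_; _≢_)

∣_-_∣ : ℕ → ℕ → ℕ
∣ i - j ∣ = (i ∸ j) + (j ∸ i)

⌈_/_⌉ : (a b : ℕ) → .{{NonZero b}} → ℕ
⌈ a / b ⌉ = (a + (b ∸ 1)) / b

-- Vertices of P_n are Fin n (v_{i+1} ↔ i); D is a list of positive integers.
-- Adjacency in the distance graph G(P_n, D): i ≠ j and |i - j| ∈ D.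
Adj : (n : ℕ) → List ℕ → Fin n → Fin n → Set
Adj n D i j = (i ≢ j) × (∣ toℕ i - toℕ j ∣ ∈ D)

ProperColouring : (n : ℕ) → List ℕ → (c : ℕ) → (Fin n → Fin c) → Set
ProperColouring n D c f = ∀ i j → Adj n D i j → f i ≢ f j

Colourable : (n : ℕ) → List ℕ → ℕ → Set
Colourable n D c = Σ (Fin n → Fin c) (ProperColouring n D c)

IsChromaticNumber : (n : ℕ) → List ℕ → ℕ → Set
IsChromaticNumber n D c = Colourable n D c × (∀ c′ → Colourable n D c′ → c ≤ c′)

ValidDistSet : (n k : ℕ) → List ℕ → Set
ValidDistSet n k D = Unique D × (∀ d → d ∈ D → (1 ≤ d × d ≤ n ∸ 1)) × (length D ≡ k)

InSpec : (n k c : ℕ) → Set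
InSpec n k c = ∃ λ D → ValidDistSet n k D × IsChromaticNumber n D c

module Submission where

open import Defs
open import Data.Nat using (ℕ; suc; _+_; _*_; _∸_; _≤_; _<_; _≮_; NonZero; >-nonZero; >-nonZero⁻¹; z≤n; s≤s)
open import Data.Nat.DivMod
open import Data.Nat.Properties
open import Data.Fin using (Fin; toℕ; fromℕ<; inject≤)
open import Data.Fin.Properties using (toℕ-fromℕ<; toℕ-inject≤; inject≤-injective; toℕ≤pred[n]; pigeonhole)
open import Data.List using (List; map; upTo)
open import Data.List.Properties using (length-map; length-upTo)
open import Data.List.Membership.Propositional using (_∈_)
open import Data.List.Membership.Propositional.Properties using (∈-map⁺; ∈-map⁻; ∈-upTo⁺; ∈-upTo⁻)
open import Data.List.Relation.Unary.Unique.Propositional.Properties using (map⁺; upTo⁺)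
open import Data.Product using (_×_; _,_)
open import Function using (_∘_)
open import Relation.Nullary using (contradiction)
open import Relation.Binary using (tri<; tri≈; tri>)
open import Relation.Binary.PropositionalEquality

-- Take as distances the first k positive integers not divisible by c = q + 1.  Colouring
-- every vertex by its index modulo c is then proper, so c colours suffice.  When q ≤ k the
-- distances 1, …, q are all present, so the first q + 1 vertices form a clique and c colours
-- are needed.  With t = ⌈n/(m+1)⌉ the hypothesis k ≤ n − t gives k + t ≤ n ≤ t(m+1), hence
-- k ≤ tm; so for q ≥ m the largest distance k + ⌊(k−1)/q⌋ is at most k + t − 1 ≤ n − 1.

∣-∣≡∸ : ∀ {i j} → i ≤ j → ∣ i - j ∣ ≡ j ∸ i
∣-∣≡∸ {i} {j} i≤j = cong (_+ (j ∸ i)) (m≤n⇒m∸n≡0 i≤j)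

∸-%-≡0 : ∀ a b c .{{_ : NonZero c}} → a % c ≡ b % c → (a ∸ b) % c ≡ 0
∸-%-≡0 a b c same = trans (cong (_% c) a∸b≡multiple) (m*n%n≡0 (a / c ∸ b / c) c)
  where
  open ≡-Reasoning
  a∸b≡multiple : a ∸ b ≡ (a / c ∸ b / c) * c
  a∸b≡multiple = begin
    a ∸ b                                     ≡⟨ cong₂ _∸_ (m≡m%n+[m/n]*n a c) (m≡m%n+[m/n]*n b c) ⟩
    (a % c + a / c * c) ∸ (b % c + b / c * c) ≡⟨ cong (λ r → (r + a / c * c) ∸ (b % c + b / c * c)) same ⟩
    (b % c + a / c * c) ∸ (b % c + b / c * c) ≡⟨ [m+n]∸[m+o]≡n∸o (b % c) _ _ ⟩
    a / c * c ∸ b / c * c                     ≡⟨ *-distribʳ-∸ c (a / c) (b / c) ⟨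
    (a / c ∸ b / c) * c                       ∎

∣-∣-%-≡0 : ∀ a b c .{{_ : NonZero c}} → a % c ≡ b % c → ∣ a - b ∣ % c ≡ 0
∣-∣-%-≡0 a b c same = begin
  ((a ∸ b) + (b ∸ a)) % c           ≡⟨ %-distribˡ-+ (a ∸ b) (b ∸ a) c ⟩
  ((a ∸ b) % c + (b ∸ a) % c) % c   ≡⟨ cong₂ (λ x y → (x + y) % c) (∸-%-≡0 a b c same) (∸-%-≡0 b a c (sym same)) ⟩
  (0 + 0) % c                       ≡⟨ m*n%n≡0 0 c ⟩
  0                                 ∎
  where open ≡-Reasoning

noMultiples⇒colourable : ∀ n D c .{{_ : NonZero c}} → (∀ d → d ∈ D → d % c ≢ 0) → Colourable n D c
noMultiples⇒colourable n D c noMultiples = residue , proper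
  where
  residue : Fin n → Fin c
  residue i = fromℕ< (m%n<n (toℕ i) c)

  proper : ProperColouring n D c residue
  proper i j (_ , dist∈D) same = noMultiples _ dist∈D (∣-∣-%-≡0 (toℕ i) (toℕ j) c sameResidue)
    where
    sameResidue : toℕ i % c ≡ toℕ j % c
    sameResidue = trans (sym (toℕ-fromℕ< _)) (trans (cong toℕ same) (toℕ-fromℕ< _))

distances1…q⇒q<colours : ∀ {n D q c} → suc q ≤ n → (∀ d → 1 ≤ d → d ≤ q → d ∈ D)
                       → Colourable n D c → q < c
distances1…q⇒q<colours {n} {D} {q} {c} q<n short (colour , proper) = ≮⇒≥ c≮1+q
  where
  vertex : Fin (suc q) → Fin n
  vertex x = inject≤ x q<n

  c≮1+q : c ≮ suc q
  c≮1+q c<1+q with i , j , i<j , same ← pigeonhole c<1+q (colour ∘ vertex) =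
    proper (vertex i) (vertex j) (distinct , dist∈D) same
    where
    distinct : vertex i ≢ vertex j
    distinct = <⇒≢ i<j ∘ cong toℕ ∘ inject≤-injective q<n q<n i j

    dist∈D : ∣ toℕ (vertex i) - toℕ (vertex j) ∣ ∈ D
    dist∈D rewrite toℕ-inject≤ i q<n | toℕ-inject≤ j q<n | ∣-∣≡∸ (<⇒≤ i<j) =
      short _ (m<n⇒0<n∸m i<j) (≤-trans (m∸n≤m (toℕ j) (toℕ i)) (toℕ≤pred[n] j))

-- The (j+1)-st positive integer not divisible by q + 1.
nonMultiple : (q : ℕ) → .{{NonZero q}} → ℕ → ℕ
nonMultiple q j = suc (j + j / q)

module _ (q : ℕ) .{{_ : NonZero q}} where

  nonMultiple-% : ∀ j → nonMultiple q j % suc q ≡ suc (j % q)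
  nonMultiple-% j = begin
    suc (j + j / q) % suc q                 ≡⟨ cong (λ r → suc (r + j / q) % suc q) (m≡m%n+[m/n]*n j q) ⟩
    suc (j % q + j / q * q + j / q) % suc q ≡⟨ cong (_% suc q) (cong suc (+-assoc (j % q) _ _)) ⟩
    suc (j % q + (j / q * q + j / q)) % suc q ≡⟨ cong (λ r → suc (j % q + r) % suc q) (+-comm (j / q * q) (j / q)) ⟩
    suc (j % q + (j / q + j / q * q)) % suc q ≡⟨ cong (λ r → suc (j % q + r) % suc q) (*-suc (j / q) q) ⟨
    (suc (j % q) + j / q * suc q) % suc q   ≡⟨ [m+kn]%n≡m%n (suc (j % q)) (j / q) (suc q) ⟩
    suc (j % q) % suc q                     ≡⟨ m<n⇒m%n≡m (s≤s (m%n<n j q)) ⟩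
    suc (j % q)                             ∎
    where open ≡-Reasoning

  nonMultiple-<-< : ∀ {i j} → i < j → nonMultiple q i < nonMultiple q j
  nonMultiple-<-< i<j = s≤s (+-mono-<-≤ i<j (/-monoˡ-≤ q (<⇒≤ i<j)))

  nonMultiple-injective : ∀ {i j} → nonMultiple q i ≡ nonMultiple q j → i ≡ j
  nonMultiple-injective {i} {j} eq with <-cmp i j
  ... | tri< i<j _ _ = contradiction eq (<⇒≢ (nonMultiple-<-< i<j))
  ... | tri≈ _ i≡j _ = i≡j
  ... | tri> _ _ j<i = contradiction (sym eq) (<⇒≢ (nonMultiple-<-< j<i))

  nonMultiple-small : ∀ {j} → j < q → nonMultiple q j ≡ suc j
  nonMultiple-small {j} j<q = trans (cong (λ r → suc (j + r)) (m<n⇒m/n≡0 j<q)) (cong suc (+-identityʳ j))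

  nonMultiples : ℕ → List ℕ
  nonMultiples k = map (nonMultiple q) (upTo k)

  nonMultiples-valid : ∀ n k → (∀ j → j < k → nonMultiple q j ≤ n ∸ 1) → ValidDistSet n k (nonMultiples k)
  nonMultiples-valid n k bounded = unique , inRange , trans (length-map _ (upTo k)) (length-upTo k)
    where
    unique = map⁺ nonMultiple-injective (upTo⁺ k)

    inRange : ∀ d → d ∈ nonMultiples k → 1 ≤ d × d ≤ n ∸ 1
    inRange d d∈ with ∈-map⁻ (nonMultiple q) d∈
    ... | j , j∈ , refl = s≤s z≤n , bounded j (∈-upTo⁻ j∈)

  χ-nonMultiples : ∀ n k → q ≤ k → suc q ≤ n → IsChromaticNumber n (nonMultiples k) (suc q)
  χ-nonMultiples n k q≤k q<n = noMultiples⇒colourable n (nonMultiples k) (suc q) notDivisible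
                             , λ _ → distances1…q⇒q<colours q<n short
    where
    notDivisible : ∀ d → d ∈ nonMultiples k → d % suc q ≢ 0
    notDivisible d d∈ with ∈-map⁻ (nonMultiple q) d∈
    ... | j , _ , refl = λ ≡0 → 0≢1+n (trans (sym ≡0) (nonMultiple-% j))

    short : ∀ d → 1 ≤ d → d ≤ q → d ∈ nonMultiples k
    short (suc e) _ e<q = subst (_∈ nonMultiples k) (nonMultiple-small e<q)
                                (∈-map⁺ (nonMultiple q) (∈-upTo⁺ (<-≤-trans e<q q≤k)))

n≤⌈n/m⌉*m : ∀ n m .{{_ : NonZero m}} → n ≤ ⌈ n / m ⌉ * m
n≤⌈n/m⌉*m n m@(suc m-1) = +-cancelʳ-≤ m-1 n (⌈ n / m ⌉ * m) (begin
  n + m-1                           ≡⟨ m≡m%n+[m/n]*n (n + m-1) m ⟩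
  (n + m-1) % m + ⌈ n / m ⌉ * m     ≤⟨ +-monoˡ-≤ _ (<⇒≤pred (m%n<n (n + m-1) m)) ⟩
  m-1 + ⌈ n / m ⌉ * m               ≡⟨ +-comm m-1 _ ⟩
  ⌈ n / m ⌉ * m + m-1               ∎)
  where open ≤-Reasoning

nonMultiple-bounded : ∀ n k m q .{{_ : NonZero m}} .{{_ : NonZero q}} → m ≤ q → 1 ≤ k
                    → k ≤ n ∸ ⌈ n / suc m ⌉ → ∀ j → j < k → nonMultiple q j ≤ n ∸ 1
nonMultiple-bounded n k m q m≤q 1≤k k≤n∸t j j<k = m+n≤o⇒m≤o∸n _ (begin
  suc (j + j / q) + 1   ≡⟨ +-comm (suc (j + j / q)) 1 ⟩
  suc (suc (j + j / q)) ≡⟨ cong suc (+-suc j (j / q)) ⟨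
  suc j + suc (j / q)   ≤⟨ +-mono-≤ j<k j/q<t ⟩
  k + t                 ≤⟨ k+t≤n ⟩
  n                     ∎)
  where
  open ≤-Reasoning
  t = ⌈ n / suc m ⌉

  k+t≤n : k + t ≤ n
  k+t≤n = m≤o∸n⇒m+n≤o k (<⇒≤ (m∸n≢0⇒n<m (≢-sym (<⇒≢ (<-≤-trans 1≤k k≤n∸t))))) k≤n∸t

  k≤t*m : k ≤ t * m
  k≤t*m = +-cancelʳ-≤ t k (t * m) (begin
    k + t        ≤⟨ k+t≤n ⟩
    n            ≤⟨ n≤⌈n/m⌉*m n (suc m) ⟩
    t * suc m    ≡⟨ *-suc t m ⟩
    t + t * m    ≡⟨ +-comm t _ ⟩
    t * m + t    ∎)

  j/q<t : j / q < t
  j/q<t = ≤-<-trans (/-monoʳ-≤ j m≤q) (m<n*o⇒m/o<n (<-≤-trans j<k k≤t*m))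

-- Of the constraints on k only k ≤ n − ⌈n/(m+1)⌉ matters; n/2 < k and the lower bound
-- merely delimit the range of k covered by this construction, and m ≥ 2 is weakened to m ≠ 0.
theorem2p3 : (n k m : ℕ) → 1 ≤ n → 1 ≤ k → n / 2 < k → k ≤ n ∸ 1
    → 2 ≤ m → .{{_ : NonZero m}} → m ≤ n ∸ 1
    → n ∸ ⌈ n / m ⌉ < k → k ≤ n ∸ ⌈ n / suc m ⌉
    → (c : ℕ) → m + 1 ≤ c → c ≤ k + 1 → InSpec n k c
theorem2p3 n k m 1≤n 1≤k _ k≤n∸1 _ _ _ k≤n∸t c m+1≤c c≤k+1 =
  spec c (subst (_≤ c) (+-comm m 1) m+1≤c) (subst (c ≤_) (+-comm k 1) c≤k+1)
  where
  k<n : k < n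
  k<n = subst (_≤ n) (+-comm k 1) (m≤o∸n⇒m+n≤o k 1≤n k≤n∸1)

  spec : ∀ c → m < c → c ≤ suc k → InSpec n k c
  spec (suc q) (s≤s m≤q) (s≤s q≤k) =
    let instance _ = >-nonZero (<-≤-trans (>-nonZero⁻¹ m) m≤q) in
    nonMultiples q k , nonMultiples-valid q n k (nonMultiple-bounded n k m q m≤q 1≤k k≤n∸t)
                     , χ-nonMultiples q n k q≤k (<-≤-trans (s≤s q≤k) k<n)
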